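{- Let $G$ be a connected $\mathrm{AT}$-free graph with a proper vertex coloring $c$, and let the source $x_0$ be a global extreme of $G$. Let $x$ and $y$ be two vertices with $c(x)=c(y)$ such that $x$ is not adjacent to $x_0$ and $y\in I(x,x_0)$. Then conquering $x$ simultaneously conquers $y$: in any sequence of moves of the solitaire Flood-it game on $(G,c,x_0)$, at the moment $x$ is added to the territory, $y$ either already belongs to the territory or is added in the same move.
   Context: An asteroidal triple is an independent set of three vertices such that every two are joined by a path avoiding the closed neighborhood of the third; $\mathrm{AT}$-free means having none. A coloring is proper if each color class is independent. Solitaire Flood-it on $(G,c,x_0)$: initially the territory is $x_0$ together with all vertices reachable from $x_0$ by a path all of color $c(x_0)$; a move calls a color $i$, recolors the territory with $i$, and the territory becomes the set of vertices reachable from $x_0$ by a path all of color $i$ (in the current coloring). A vertex is conquered when it is added to the territory. For nonadjacent $x,y$, a vertex $z$ is between $x$ and $y$ if $x,z$ lie in a common component of $G-N[y]$ and $y,z$ lie in a common component of $G-N[x]$; the interval $I(x,y)$ is the set of vertices between $x$ and $y$. Extremes: for a vertex $v$ of a connected graph $H$ let $m_H(v)$ be the maximum size of a component of $H-N[v]$ ($0$ if empty); $v$ is an extreme of $H$ if $m_H(v)$ is maximum over $V(H)$. Global extremes of a connected graph $H$: pick an extreme $x$ of $H$, a largest component $C$ of $H-N[x]$, and set $X=V(H)\setminus(N(C)\cup C)$ (with $X=V(H)$ if $H$ is complete); if $H[X]$ is a disjoint union of cliques, every element of $X$ is a global extreme of $H$; otherwise a global extreme of $H$ is (recursively) a global extreme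 of some component of $H[X]$. -}

module Defs where

open import Data.Nat using (ℕ; _≤_)
open import Data.Fin using (Fin)
open import Data.List using (List; length)
open import Data.List.Membership.Propositional using (_∈_)
open import Data.List.Relation.Unary.Unique.Propositional using (Unique)
open import Data.Product using (Σ; _×_; ∃)
open import Data.Sum using (_⊎_)
open import Data.Unit using (⊤)
open import Data.Empty using (⊥)
open import Relation.Nullary using (¬_)
open import Relation.Binary using (Decidable)
open import Relation.Binary.PropositionalEquality using (_≡_; _≢_)
open import Function.Bundles using (_⇔_)

record Graph : Set₁ where
  field
    n      : ℕ
    Adj    : Fin n → Fin n → Set
    Adj?   : Decidable Adj
    sym    : ∀ {u v} → Adj u v → Adj v u
    irrefl : ∀ {u} → ¬ Adj u u

module _ (G : Graph) where
  open Graph G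

  V : Set
  V = Fin n

  VSet : Set₁
  VSet = V → Set

  data Reach (P : VSet) : V → V → Set where
    here : ∀ {u} → P u → Reach P u u
    step : ∀ {u w v} → P u → Adj u w → Reach P w v → Reach P u v

  N[_] : V → VSet
  N[ v ] w = (w ≡ v) ⊎ Adj v w

  _∖N[_] : VSet → V → VSet
  (S ∖N[ v ]) w = S w × ¬ (N[ v ] w)

  Everything : VSet
  Everything _ = ⊤

  Connected : Set
  Connected = ∀ u v → Reach Everything u v

  AsteroidalTriple : V → V → V → Set
  AsteroidalTriple a b c =
    ¬ Adj a b × ¬ Adj a c × ¬ Adj b c × a ≢ b × a ≢ c × b ≢ c ×
    Reach (Everything ∖N[ c ]) a b ×
    Reach (Everything ∖N[ b ]) a c ×
    Reach (Everything ∖N[ a ]) b c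

  ATFree : Set
  ATFree = ∀ a b c → ¬ AsteroidalTriple a b c

  Coloring : Set
  Coloring = V → ℕ

  Proper : Coloring → Set
  Proper c = ∀ {u v} → Adj u v → c u ≢ c v

  HasSize : VSet → ℕ → Set
  HasSize A k = Σ (List V) λ xs → Unique xs × (∀ w → (w ∈ xs) ⇔ A w) × length xs ≡ k

  Comp : VSet → V → VSet
  Comp P u = Reach P u

  -- interval I(x,y) (for nonadjacent x, y)
  Between : V → V → V → Set
  Between x y z = Reach (Everything ∖N[ y ]) x z × Reach (Everything ∖N[ x ]) y z

  MaxCompSize : VSet → V → ℕ → Set
  MaxCompSize S v m =
    (∀ u k → (S ∖N[ v ]) u → HasSize (Comp (S ∖N[ v ]) u) k → k ≤ m) ×
    ((m ≡ 0) ⊎ ∃ λ u → (S ∖N[ v ]) u × HasSize (Comp (S ∖N[ v ]) u) m)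

  Extreme : VSet → V → Set
  Extreme S x = S x × Σ ℕ λ m → MaxCompSize S x m ×
    (∀ v m' → S v → MaxCompSize S v m' → m' ≤ m)

  Complete : VSet → Set
  Complete S = ∀ u v → S u → S v → u ≢ v → Adj u v

  DisjointCliques : VSet → Set
  DisjointCliques X = ∀ a b → Reach X a b → (a ≡ b) ⊎ Adj a b

  Rest : VSet → VSet → VSet
  Rest S C w = S w × ¬ C w × ¬ (∃ λ c → C c × Adj w c)

  data GlobalExtreme (S : VSet) : V → Set₁ where
    complete : ∀ {z} → Complete S → S z → GlobalExtreme S z
    base     : ∀ {x u m z} → Extreme S x → MaxCompSize S x m →
               (S ∖N[ x ]) u → HasSize (Comp (S ∖N[ x ]) u) m →
               DisjointCliques (Rest S (Comp (S ∖N[ x ]) u)) →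
               Rest S (Comp (S ∖N[ x ]) u) z → GlobalExtreme S z
    recurse  : ∀ {x u m r z} → Extreme S x → MaxCompSize S x m →
               (S ∖N[ x ]) u → HasSize (Comp (S ∖N[ x ]) u) m →
               ¬ DisjointCliques (Rest S (Comp (S ∖N[ x ]) u)) →
               Rest S (Comp (S ∖N[ x ]) u) r →
               GlobalExtreme (Comp (Rest S (Comp (S ∖N[ x ]) u)) r) z →
               GlobalExtreme S z

  Territory : V → Coloring → VSet
  Territory x0 col = Reach (λ v → col v ≡ col x0) x0

  Move : V → Coloring → ℕ → Coloring → Set
  Move x0 col i col' = ∀ v → (Territory x0 col v → col' v ≡ i) ×
                             (¬ Territory x0 col v → col' v ≡ col v)

  data Play (x0 : V) (c : Coloring) : Coloring → Set where
    start : Play x0 c c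
    move  : ∀ {col i col'} → Play x0 c col → Move x0 col i col' → Play x0 c col'

module Submission where

-- The heart of the argument is a purely graph-theoretic
-- fact about AT-free graphs: if y ∈ I(x, x0) then EVERY path from x0 to x
-- meets N[y], since a path avoiding N[y] would make {x0, x, y} an asteroidal
-- triple (the other two required paths are exactly the definition of y being
-- between x and x0).  Applied to a monochromatic path witnessing that x is in
-- the territory, this shows that y is in the territory as soon as it carries
-- the territory colour.
--
-- The theorem
-- follows: if x is conquered by a move, then after the move y has the colour
-- of x (it was either recoloured with the called colour or never touched, so
-- it keeps c y = c x), hence y belongs to the new territory as well.

open import Defs
open import Data.Product using (_×_; _,_; proj₁; proj₂; Σ)
open import Data.Sum using (_⊎_; inj₁; inj₂)
open import Data.Unit using (tt)
open import Data.Empty using (⊥-elim)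
open import Relation.Nullary using (¬_; yes; no)
open import Relation.Binary.PropositionalEquality using (_≡_; refl; sym; trans; module ≡-Reasoning)
open import Data.Fin using (_≟_)
open import Data.Nat using () renaming (_≟_ to _≟ℕ_)

module Paths (G : Graph) where
  open Graph G using (Adj; Adj?)

  Reach-first : ∀ {P a b} → Reach G P a b → P a
  Reach-first (here p)     = p
  Reach-first (step p _ _) = p

  Reach-last : ∀ {P a b} → Reach G P a b → P b
  Reach-last (here p)     = p
  Reach-last (step _ _ r) = Reach-last r

  Reach-snoc : ∀ {P a w v} → Reach G P a w → Adj w v → P v → Reach G P a v
  Reach-snoc (here p)       w~v pv = step p w~v (here pv)
  Reach-snoc (step p a~ r)  w~v pv = step p a~ (Reach-snoc r w~v pv)

  Reach-transport : ∀ {P Q : VSet G} {a v} →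
                    (∀ u → Reach G P a u → Q u) → Reach G P a v → Reach G Q a v
  Reach-transport f (here p)       = here (f _ (here p))
  Reach-transport f (step p a~ r) =
    step (f _ (here p)) a~ (Reach-transport (λ u r′ → f u (step p a~ r′)) r)

  N[]-dec : ∀ y w → N[_] G y w ⊎ ¬ N[_] G y w
  N[]-dec y w with w ≟ y | Adj? y w
  ... | yes w≡y | _        = inj₁ (inj₁ w≡y)
  ... | no  _   | yes y~w  = inj₁ (inj₂ y~w)
  ... | no  w≢y | no  y≁w  = inj₂ λ { (inj₁ w≡y) → w≢y w≡y ; (inj₂ y~w) → y≁w y~w }

  HitsN[_] : V G → VSet G → V G → Set
  HitsN[ y ] P a = Σ (V G) λ w → Reach G P a w × N[_] G y w

  hits-or-avoids : ∀ {P} y {a b} → Reach G P a b →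
                   HitsN[ y ] P a ⊎ Reach G (_∖N[_] G (Everything G) y) a b
  hits-or-avoids y {a} r with N[]-dec y a
  hits-or-avoids y {a} r | inj₁ a∈N = inj₁ (a , here (Reach-first r) , a∈N)
  hits-or-avoids y (here p)       | inj₂ a∉N = inj₂ (here (tt , a∉N))
  hits-or-avoids y (step p a~ r)  | inj₂ a∉N with hits-or-avoids y r
  ... | inj₁ (w , r′ , w∈N) = inj₁ (w , step p a~ r′ , w∈N)
  ... | inj₂ avoid           = inj₂ (step (tt , a∉N) a~ avoid)

module ATFreeIntervals (G : Graph) where
  open Graph G using (Adj)
  open Paths G

  interval-asteroidal : ∀ {x0 x y} → ¬ Adj x x0 → Between G x x0 y →
                        Reach G (_∖N[_] G (Everything G) y) x0 x →
                        AsteroidalTriple G x0 x y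
  interval-asteroidal x≁x0 (x⇝y , x0⇝y) x0⇝x =
    ( (λ x0~x → x≁x0 (Graph.sym G x0~x))
    , (λ x0~y → y∉N[x0] (inj₂ x0~y))
    , (λ x~y  → y∉N[x] (inj₂ x~y))
    , (λ x0≡x → x∉N[x0] (inj₁ (sym x0≡x)))
    , (λ x0≡y → y∉N[x0] (inj₁ (sym x0≡y)))
    , (λ x≡y  → y∉N[x] (inj₁ (sym x≡y)))
    , x0⇝x , x0⇝y , x⇝y )
    where
    y∉N[x0] = proj₂ (Reach-last x⇝y)
    x∉N[x0] = proj₂ (Reach-first x⇝y)
    y∉N[x]  = proj₂ (Reach-last x0⇝y)

  interval-blocks-paths : ATFree G → ∀ {P x0 x y} → ¬ Adj x x0 → Between G x x0 y →
                          Reach G P x0 x → HitsN[ y ] P x0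
  interval-blocks-paths atf {x0 = x0} {x} {y} x≁x0 btw r with hits-or-avoids y r
  ... | inj₁ hit   = hit
  ... | inj₂ avoid = ⊥-elim (atf x0 x y (interval-asteroidal x≁x0 btw avoid))

  interval-in-territory : ATFree G → ∀ {x0 x y} → ¬ Adj x x0 → Between G x x0 y →
                          (col : Coloring G) → Territory G x0 col x → col y ≡ col x →
                          Territory G x0 col y
  interval-in-territory atf x≁x0 btw col tx cy≡cx
    with interval-blocks-paths atf x≁x0 btw tx
  ... | (w , x0⇝w , inj₁ refl) = x0⇝w
  ... | (w , x0⇝w , inj₂ y~w)  =
    Reach-snoc x0⇝w (Graph.sym G y~w) (trans cy≡cx (Reach-last tx))

module FloodIt (G : Graph) (x0 : V G) where
  open Paths G

  move-source-colour : ∀ {col i col′} → Move G x0 col i col′ → col′ x0 ≡ i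
  move-source-colour mv = proj₁ (mv x0) (here refl)

  territory-colour : ∀ {col v} → Territory G x0 col v → col v ≡ col x0
  territory-colour = Reach-last

  -- A move never shrinks the territory: its old vertices all get colour i.
  move-grows-territory : ∀ {col i col′} → Move G x0 col i col′ →
                         ∀ {v} → Territory G x0 col v → Territory G x0 col′ v
  move-grows-territory mv =
    Reach-transport (λ u tu → trans (proj₁ (mv u) tu) (sym (move-source-colour mv)))

  unconquered-keeps-colour : ∀ {c col} → Play G x0 c col →
                             ∀ {v} → ¬ Territory G x0 col v → col v ≡ c v
  unconquered-keeps-colour start _ = refl
  unconquered-keeps-colour (move pl mv) {v} ∉T′ =
    trans (proj₂ (mv v) ∉T) (unconquered-keeps-colour pl ∉T)
    where
    ∉T = λ t → ∉T′ (move-grows-territory mv t)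

  conquered-colour : ∀ {col i col′ v} → Move G x0 col i col′ →
                     Territory G x0 col′ v → col′ v ≡ i
  conquered-colour mv t = trans (territory-colour t) (move-source-colour mv)

  same-colour-after-conquest :
    ∀ {c col i col′ x y} → c x ≡ c y → Play G x0 c col → Move G x0 col i col′ →
    ¬ Territory G x0 col x → Territory G x0 col′ x → col′ y ≡ col′ x
  same-colour-after-conquest {c} {col} {i} {col′} {x} {y} cx≡cy pl mv x∉T x∈T′
    with col′ y ≟ℕ i
  ... | yes cy≡i = trans cy≡i (sym (conquered-colour mv x∈T′))
  ... | no  cy≢i = begin
      col′ y ≡⟨ proj₂ (mv y) y∉T ⟩
      col y  ≡⟨ unconquered-keeps-colour pl y∉T ⟩
      c y    ≡⟨ sym cx≡cy ⟩
      c x    ≡⟨ sym (unconquered-keeps-colour pl x∉T) ⟩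
      col x  ≡⟨ sym (proj₂ (mv x) x∉T) ⟩
      col′ x ∎
    where
    open ≡-Reasoning
    y∉T : ¬ Territory G x0 col y
    y∉T y∈T = cy≢i (proj₁ (mv y) y∈T)

mainTheorem5 : (G : Graph) → Connected G → ATFree G →
    (c : Coloring G) → Proper G c →
    (x0 : V G) → GlobalExtreme G (Everything G) x0 →
    (x y : V G) → c x ≡ c y → ¬ Graph.Adj G x x0 → Between G x x0 y →
    (Territory G x0 c x → Territory G x0 c y) ×
    (∀ col i col' → Play G x0 c col → Move G x0 col i col' →
      ¬ Territory G x0 col x → Territory G x0 col' x →
      Territory G x0 col y ⊎ Territory G x0 col' y)
mainTheorem5 G _ atf c _ x0 _ x y cx≡cy x≁x0 btw = initially , conquest
  where
  open ATFreeIntervals G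
  open FloodIt G x0
  initially : Territory G x0 c x → Territory G x0 c y
  initially x∈T = interval-in-territory atf x≁x0 btw c x∈T (sym cx≡cy)
  conquest : ∀ col i col′ → Play G x0 c col → Move G x0 col i col′ →
             ¬ Territory G x0 col x → Territory G x0 col′ x →
             Territory G x0 col y ⊎ Territory G x0 col′ y
  conquest col i col′ pl mv x∉T x∈T′ =
    inj₂ (interval-in-territory atf x≁x0 btw col′ x∈T′
           (same-colour-after-conquest cx≡cy pl mv x∉T x∈T′))
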